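{- Let $(\mathfrak{B}_\tau,\sim)$ be a $\tau\sim$-expansion and let $\mathfrak{A}_\tau$ be a subalgebra of the $\tau$-expansion $\mathfrak{B}_\tau$ (a Heyting subalgebra of $\mathfrak{B}$ containing the element interpreting $\tau$), regarded as a partial algebra $(\mathfrak{A}_\tau,\sim)$ with $\sim$ restricted. Then the following are equivalent: (a) $|\mathfrak{A}|$ is closed under $\sim$; (b) there is $a\in|\mathfrak{A}|$ with $\sim a\in|\mathfrak{A}|$ and $\sim\sim a\in|\mathfrak{A}|$; (c) $\sim\mathbf{0}\in|\mathfrak{A}|$.
   Context: A $\sim$-negation on a Heyting algebra is a unary operation $\sim$ satisfying for all $x,y$: $x\rightarrow y\le\sim y\rightarrow\sim x$; $x\wedge\sim x\le\sim\mathbf{1}$; $\sim\mathbf{0}\le x\vee\sim x$; $\sim\mathbf{0}\rightarrow\sim\mathbf{1}\le\sim\mathbf{1}$. A $\tau$-expansion is a Heyting algebra with an additional constant $\tau$. A $\tau\sim$-expansion $(\mathfrak{B}_\tau,\sim)$ is a $\tau$-expansion together with a $\sim$-negation satisfying $\sim\mathbf{1}=\tau$. -}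

module Defs where

open import Level using (Level; _⊔_; suc)
open import Data.Product using (∃-syntax; _×_)
open import Relation.Unary using (Pred; _∈_)
open import Relation.Binary.Lattice.Bundles using (HeytingAlgebra)

record IsSimNegation {c ℓ₁ ℓ₂ : Level} (H : HeytingAlgebra c ℓ₁ ℓ₂)
                     (∼ : HeytingAlgebra.Carrier H → HeytingAlgebra.Carrier H)
                     : Set (c ⊔ ℓ₂) where
  open HeytingAlgebra H
  field
    contra : ∀ x y → (x ⇨ y) ≤ (∼ y ⇨ ∼ x)
    ax2    : ∀ x → (x ∧ ∼ x) ≤ ∼ ⊤
    ax3    : ∀ x → ∼ ⊥ ≤ (x ∨ ∼ x)
    ax4    : (∼ ⊥ ⇨ ∼ ⊤) ≤ ∼ ⊤

record TauSimExpansion (c ℓ₁ ℓ₂ : Level) : Set (suc (c ⊔ ℓ₁ ⊔ ℓ₂)) where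
  field
    heyting : HeytingAlgebra c ℓ₁ ℓ₂
  open HeytingAlgebra heyting
  field
    τ       : Carrier
    ∼       : Carrier → Carrier
    isSimNegation : IsSimNegation heyting ∼
    ∼⊤≈τ    : ∼ ⊤ ≈ τ

record IsTauSubalgebra {c ℓ₁ ℓ₂ ℓ : Level} (E : TauSimExpansion c ℓ₁ ℓ₂)
                       (A : Pred (HeytingAlgebra.Carrier (TauSimExpansion.heyting E)) ℓ)
                       : Set (c ⊔ ℓ₁ ⊔ ℓ) where
  open TauSimExpansion E
  open HeytingAlgebra heyting
  field
    respects : ∀ {x y} → x ≈ y → x ∈ A → y ∈ A
    ⊤∈ : ⊤ ∈ A
    ⊥∈ : ⊥ ∈ A
    τ∈ : τ ∈ A
    ∧∈ : ∀ {x y} → x ∈ A → y ∈ A → (x ∧ y) ∈ A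
    ∨∈ : ∀ {x y} → x ∈ A → y ∈ A → (x ∨ y) ∈ A
    ⇨∈ : ∀ {x y} → x ∈ A → y ∈ A → (x ⇨ y) ∈ A

module _ {c ℓ₁ ℓ₂ ℓ : Level} (E : TauSimExpansion c ℓ₁ ℓ₂)
         (A : Pred (HeytingAlgebra.Carrier (TauSimExpansion.heyting E)) ℓ) where
  open TauSimExpansion E
  open HeytingAlgebra heyting

  ClosedUnder∼ : Set (c ⊔ ℓ)
  ClosedUnder∼ = ∀ x → x ∈ A → ∼ x ∈ A

  SomeDoubleSim : Set (c ⊔ ℓ)
  SomeDoubleSim = ∃[ a ] (a ∈ A × ∼ a ∈ A × ∼ (∼ a) ∈ A)

  Sim⊥In : Set ℓ
  Sim⊥In = ∼ ⊥ ∈ A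

-- A ∼-negation is determined by the two constants ∼ 0 and ∼ 1:
-- ∼ x = ∼ 0 ∧ (x → ∼ 1).  Hence a τ-subalgebra (which contains ∼ 1 = τ) is
-- closed under ∼ as soon as it contains ∼ 0.  Conversely ∼ 0 = ∼ a ∨ ∼∼ a
-- for every a, so ∼ 0 lies in any subalgebra containing some ∼ a and ∼∼ a.
module Submission where

open import Defs
open import Level using (Level)
open import Data.Product using (_×_; _,_)
open import Function.Base using (_∘_)
open import Function.Bundles using (_⇔_; mk⇔)
open import Relation.Unary using (Pred)
open import Relation.Binary.Lattice.Bundles using (HeytingAlgebra)
import Relation.Binary.Lattice.Properties.HeytingAlgebra as HeytingAlgebraProperties

module SimNegationProperties
  {c ℓ₁ ℓ₂ : Level} (H : HeytingAlgebra c ℓ₁ ℓ₂)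
  {∼ : HeytingAlgebra.Carrier H → HeytingAlgebra.Carrier H}
  (isSimNegation : IsSimNegation H ∼) where

  open HeytingAlgebra H
  open HeytingAlgebraProperties H using (⇨-eval; ⇨-applyʳ; swap-transpose-⇨; y≤x⇨y)
  open IsSimNegation isSimNegation

  ∼-antitone : ∀ {x y} → x ≤ y → ∼ y ≤ ∼ x
  ∼-antitone {x} {y} x≤y = trans (∧-greatest refl ∼y≤∼y⇨∼x) (⇨-applyʳ refl)
    where
      ∼y≤∼y⇨∼x : ∼ y ≤ (∼ y ⇨ ∼ x)
      ∼y≤∼y⇨∼x = trans (maximum (∼ y))
                  (trans (swap-transpose-⇨ (trans (x∧y≤x x ⊤) x≤y)) (contra x y))

  ∼-≤-∼⊥∧⇨∼⊤ : ∀ x → ∼ x ≤ (∼ ⊥ ∧ (x ⇨ ∼ ⊤))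
  ∼-≤-∼⊥∧⇨∼⊤ x = ∧-greatest (∼-antitone (minimum x)) (swap-transpose-⇨ (ax2 x))

  -- ∼ 0 ≤ x ∨ ∼ x, and either disjunct together with x → ∼ 1 yields ∼ x.
  ∼⊥∧⇨∼⊤-≤-∼ : ∀ x → (∼ ⊥ ∧ (x ⇨ ∼ ⊤)) ≤ ∼ x
  ∼⊥∧⇨∼⊤-≤-∼ x = transpose-∧ (trans (ax3 x) (∨-least x≤ y≤x⇨y))
    where
      x≤ : x ≤ ((x ⇨ ∼ ⊤) ⇨ ∼ x)
      x≤ = swap-transpose-⇨ (trans ⇨-eval (∼-antitone (maximum x)))

  ∼≈∼⊥∧⇨∼⊤ : ∀ x → ∼ x ≈ (∼ ⊥ ∧ (x ⇨ ∼ ⊤))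
  ∼≈∼⊥∧⇨∼⊤ x = antisym (∼-≤-∼⊥∧⇨∼⊤ x) (∼⊥∧⇨∼⊤-≤-∼ x)

  ∼⊥≈∼x∨∼∼x : ∀ x → ∼ ⊥ ≈ (∼ x ∨ ∼ (∼ x))
  ∼⊥≈∼x∨∼∼x x =
    antisym (ax3 (∼ x)) (∨-least (∼-antitone (minimum x)) (∼-antitone (minimum (∼ x))))

module _ {c ℓ₁ ℓ₂ ℓ : Level} (E : TauSimExpansion c ℓ₁ ℓ₂)
         {A : Pred (HeytingAlgebra.Carrier (TauSimExpansion.heyting E)) ℓ}
         (isSubalgebra : IsTauSubalgebra E A) where

  open TauSimExpansion E
  open HeytingAlgebra heyting
  open IsTauSubalgebra isSubalgebra
  open SimNegationProperties heyting isSimNegation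

  closedUnder∼⇒someDoubleSim : ClosedUnder∼ E A → SomeDoubleSim E A
  closedUnder∼⇒someDoubleSim closed = ⊤ , ⊤∈ , closed ⊤ ⊤∈ , closed (∼ ⊤) (closed ⊤ ⊤∈)

  someDoubleSim⇒sim⊥In : SomeDoubleSim E A → Sim⊥In E A
  someDoubleSim⇒sim⊥In (a , _ , ∼a∈ , ∼∼a∈) =
    respects (Eq.sym (∼⊥≈∼x∨∼∼x a)) (∨∈ ∼a∈ ∼∼a∈)

  sim⊥In⇒closedUnder∼ : Sim⊥In E A → ClosedUnder∼ E A
  sim⊥In⇒closedUnder∼ ∼⊥∈ x x∈ =
    respects (Eq.sym (∼≈∼⊥∧⇨∼⊤ x)) (∧∈ ∼⊥∈ (⇨∈ x∈ (respects (Eq.sym ∼⊤≈τ) τ∈)))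

propositionP : {c ℓ₁ ℓ₂ ℓ : Level} (E : TauSimExpansion c ℓ₁ ℓ₂)
               (A : Pred (HeytingAlgebra.Carrier (TauSimExpansion.heyting E)) ℓ) →
               IsTauSubalgebra E A →
               (ClosedUnder∼ E A ⇔ SomeDoubleSim E A) × (SomeDoubleSim E A ⇔ Sim⊥In E A)
propositionP E A S =
  mk⇔ (closedUnder∼⇒someDoubleSim E S) (sim⊥In⇒closedUnder∼ E S ∘ someDoubleSim⇒sim⊥In E S) ,
  mk⇔ (someDoubleSim⇒sim⊥In E S) (closedUnder∼⇒someDoubleSim E S ∘ sim⊥In⇒closedUnder∼ E S)
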